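{- ${\rm ML}^{\rm W}(K_3)=3$, and ${\rm ML}^{\rm W}(K_n)=\frac{n^2-5n+10}{2}$ for every $n \geq 4$, where $K_n$ is the complete graph on $n$ vertices.
   Context: A walk of a graph $G$ is a sequence of vertices in which consecutive vertices are adjacent (repetitions allowed); its length is its number of traversed edges with repetition. For a walk $W$, $G+W$ is the multigraph on $V(G)$ with edge multiset $E(G)$ plus every edge traversed by $W$, added as many times as traversed. A multigraph is locally irregular if no two adjacent vertices have the same degree; $W$ is irregularising if $G+W$ is locally irregular. ${\rm ML}^{\rm W}(G)$ is the minimum length of an irregularising walk of $G$ (length $0$ allowed), $+\infty$ if none exists. -}

module Defs where

open import Data.Nat using (ℕ; zero; suc; _+_; _∸_)
open import Data.Bool using (Bool; true; false; not; if_then_else_)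
open import Data.Fin using (Fin)
open import Data.Fin.Properties using (_≟_)
open import Data.List using (List; []; _∷_; length; filter; allFin)
open import Relation.Binary.PropositionalEquality using (_≡_; _≢_)
open import Relation.Nullary.Decidable using (⌊_⌋)

record SimpleGraph (n : ℕ) : Set where
  field
    adj   : Fin n → Fin n → Bool
    adj-sym : ∀ u v → adj u v ≡ adj v u
    irrefl : ∀ v → adj v v ≡ false
open SimpleGraph public

_==_ : ∀ {n} → Fin n → Fin n → Bool
u == v = ⌊ u ≟ v ⌋

deg : ∀ {n} → SimpleGraph n → Fin n → ℕ
deg G v = length (filter (λ u → adj G v u ≡? true) (allFin _))
  where
  open import Data.Bool.Properties using () renaming (_≟_ to _≡?_)

IsWalk : ∀ {n} → SimpleGraph n → List (Fin n) → Set
IsWalk G []           = Data.Unit.⊤ where import Data.Unit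
IsWalk G (u ∷ [])     = Data.Unit.⊤ where import Data.Unit
IsWalk G (u ∷ v ∷ w)  = (adj G u v ≡ true) Data.Product.× IsWalk G (v ∷ w)
  where import Data.Product

walkLength : ∀ {n} → List (Fin n) → ℕ
walkLength w = length w ∸ 1

walkInc : ∀ {n} → List (Fin n) → Fin n → ℕ
walkInc []          x = 0
walkInc (u ∷ [])    x = 0
walkInc (u ∷ v ∷ w) x =
  (if u == x then 1 else 0) + (if v == x then 1 else 0) + walkInc (v ∷ w) x

-- Degree of v in the multigraph G + W.
degPlus : ∀ {n} → SimpleGraph n → List (Fin n) → Fin n → ℕ
degPlus G w v = deg G v + walkInc w v

-- G + W is locally irregular (its adjacency coincides with that of G, since
-- W only traverses edges of G).
Irregularising : ∀ {n} → SimpleGraph n → List (Fin n) → Set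
Irregularising G w =
  ∀ u v → adj G u v ≡ true → degPlus G w u ≢ degPlus G w v

-- ML^W(G) = m  (in particular finite): some irregularising walk has length m
-- and every irregularising walk has length ≥ m.
MLW≡ : ∀ {n} → SimpleGraph n → ℕ → Set
MLW≡ G m =
  (Data.Product.Σ (List _) λ w → IsWalk G w Data.Product.× Irregularising G w
      Data.Product.× walkLength w ≡ m)
  Data.Product.×
  (∀ w → IsWalk G w → Irregularising G w → m Data.Nat.≤ walkLength w)
  where import Data.Product; import Data.Nat

K : (n : ℕ) → SimpleGraph n
K n = record { adj = λ u v → not (u == v) ; adj-sym = symK ; irrefl = irreflK }
  where
  open import Relation.Binary.PropositionalEquality using (refl; sym)
  open import Relation.Nullary using (yes; no)
  symK : ∀ u v → not (u == v) ≡ not (v == u)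
  symK u v with u ≟ v | v ≟ u
  ... | yes _ | yes _ = refl
  ... | no _  | no _  = refl
  ... | yes p | no q  = Data.Empty.⊥-elim (q (sym p)) where import Data.Empty
  ... | no p  | yes q = Data.Empty.⊥-elim (p (sym q)) where import Data.Empty
  irreflK : ∀ v → not (v == v) ≡ false
  irreflK v with v ≟ v
  ... | yes _ = refl
  ... | no p  = Data.Empty.⊥-elim (p refl) where import Data.Empty

{-# OPTIONS --safe #-}
-- In K_n every vertex has degree n - 1, so a walk W is irregularising exactly
-- when its increments walkInc W are pairwise distinct. Every interior visit
-- of a vertex adds 2 to its increment and each end of W adds 1, so only the
-- two ends can have odd increments, while all increments sum to twice the
-- length of W. Thus n distinct naturals, at most two of them odd, sum to
-- 2 * length W; with e even and o <= 2 odd ones the sum is at least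
-- e (e - 1) + o^2 >= n^2 - 5n + 10 for n >= 4.
-- The bound is attained by the walk 1, 2, S, 2 in which S visits vertex 3 + j
-- exactly j + 1 times: its increments are 0, 1, 3, 2, 4, ..., 2 (n - 3).
-- For K_3 the formula would give 2, but no walk of length at most 2 in a
-- complete graph is irregularising, while 0, 1, 2, 1 is.
module Submission where

open import Defs
open import Data.Bool using (Bool; true; false; not; if_then_else_)
open import Data.Bool.Properties using (not-involutive; not-¬; ¬-not) renaming (_≟_ to _≟ᵇ_)
open import Data.Empty using (⊥-elim)
open import Data.Fin using (Fin; zero; suc; toℕ; fromℕ; inject₁; _↑ʳ_)
open import Data.Fin.Patterns using (0F; 1F; 2F)
open import Data.Fin.Properties using (_≟_; all?; ↑ʳ-injective; toℕ-injective; toℕ-inject₁; toℕ-fromℕ)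
  renaming (suc-injective to Fin-suc-injective)
open import Data.List using (List; []; _∷_; _++_; length; filter; allFin; tabulate; map; last)
open import Data.List.Properties using (length-tabulate; length-++)
open import Data.List.Relation.Binary.Permutation.Propositional
  using (_↭_; ↭-refl; ↭-prep; ↭-trans; ↭-sym; ↭⇒↭ₛ)
open import Data.List.Relation.Binary.Permutation.Propositional.Properties using (shift; ↭-length; filter-↭)
open import Data.List.Relation.Unary.All as All using (All; []; _∷_)
open import Data.List.Relation.Unary.All.Properties using (all-filter; tabulate⁺)
  renaming (map⁺ to All-map⁺; filter⁺ to All-filter⁺)
open import Data.List.Relation.Unary.AllPairs using ([]; _∷_)
open import Data.List.Relation.Unary.Linked as Linked using (Linked; []; [-]; _∷_)
import Data.List.Relation.Unary.Linked.Properties as Linked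
open import Data.List.Relation.Unary.Unique.Propositional using (Unique)
import Data.List.Relation.Unary.Unique.Propositional.Properties as Unique
open import Data.Maybe using (just)
open import Data.Maybe.Relation.Binary.Connected using (Connected; just; nothing-just)
open import Data.Nat using (ℕ; zero; suc; _+_; _*_; _≤_; _<_; z≤n; s≤s)
  renaming (_≟_ to _≟ℕ_)
open import Data.Nat.ListAction using (sum)
open import Data.Nat.ListAction.Properties using (sum-↭; sum-++)
open import Data.Nat.Properties
  using ( +-0-commutativeMonoid; ≤-decTotalOrder; module ≤-Reasoning
        ; +-assoc; +-comm; +-suc; +-identityʳ; *-suc; *-distribˡ-+; suc-injective
        ; +-cancelˡ-≡; +-cancelʳ-≡; *-cancelˡ-≡; +-cancelʳ-≤; *-cancelˡ-≤
        ; ≤-trans; ≤-reflexive; <-trans; m≤n+m; m≤m+n; +-mono-≤; +-monoˡ-≤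
        ; m≤n⇒m<n∨m≡n; m≤n⇒∃[o]m+o≡n; ≤∧≢⇒<; ≰⇒>; even≢odd )
open import Data.Nat.Tactic.RingSolver using (solve-∀)
open import Data.Product using (_×_; _,_; ∃₂)
open import Data.Sum using (_⊎_; inj₁; inj₂) renaming (map to ⊎-map)
open import Data.Unit using (tt)
open import Function using (_∘_)
open import Function.Definitions using (Injective)
open import Relation.Binary.PropositionalEquality
open import Relation.Binary.PropositionalEquality.Properties using (setoid)
open import Relation.Nullary using (yes; no)
open import Relation.Nullary.Decidable using (decidable-stable; toWitness; _→-dec_; ¬?)
open import Relation.Nullary.Negation using (contradiction)
open import Relation.Unary using (Pred; Decidable)
open import Relation.Unary.Properties using (∁?)
open import Algebra.Properties.CommutativeMonoid.Sum +-0-commutativeMonoid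
  using (sum-syntax; ∑-distrib-+; sum-replicate-zero; sum-cong-≗; sum-init-last)
open import Data.List.Sort ≤-decTotalOrder using (sort; sort-↭; sort-↗)
open import Data.List.Relation.Binary.Permutation.Setoid.Properties (setoid ℕ) using (Unique-resp-↭)

δ : ∀ {n} → Fin n → Fin n → ℕ
δ u x = if u == x then 1 else 0

δ-refl : ∀ {n} (x : Fin n) → δ x x ≡ 1
δ-refl x with x ≟ x
... | yes _   = refl
... | no x≢x = contradiction refl x≢x

δ-≢ : ∀ {n} {u x : Fin n} → u ≢ x → δ u x ≡ 0
δ-≢ {u = u} {x} u≢x with u ≟ x
... | yes u≡x = contradiction u≡x u≢x
... | no _    = refl

δ-comm : ∀ {n} (u x : Fin n) → δ u x ≡ δ x u
δ-comm u x with u ≟ x | x ≟ u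
... | yes _   | yes _   = refl
... | no _    | no _    = refl
... | yes u≡x | no x≢u  = contradiction (sym u≡x) x≢u
... | no u≢x  | yes x≡u = contradiction (sym x≡u) u≢x

δ-injective : ∀ {m n} {f : Fin m → Fin n} → Injective _≡_ _≡_ f → ∀ u x → δ (f u) (f x) ≡ δ u x
δ-injective {f = f} inj u x with u ≟ x
... | yes refl = δ-refl (f u)
... | no u≢x   = δ-≢ (u≢x ∘ inj)

∑-δ : ∀ {n} (u : Fin n) → ∑[ x < n ] δ u x ≡ 1
∑-δ {suc n} zero    = cong suc (sum-replicate-zero n)
∑-δ {suc n} (suc u) = trans (sum-cong-≗ (δ-injective Fin-suc-injective u)) (∑-δ u)

handshake : ∀ {n} (w : List (Fin n)) → ∑[ x < n ] walkInc w x ≡ 2 * walkLength w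
handshake {n} []          = sum-replicate-zero n
handshake {n} (u ∷ [])    = sum-replicate-zero n
handshake {n} (u ∷ v ∷ w) = begin
  ∑[ x < n ] (δ u x + δ v x + walkInc (v ∷ w) x)
    ≡⟨ ∑-distrib-+ (λ x → δ u x + δ v x) (walkInc (v ∷ w)) ⟩
  ∑[ x < n ] (δ u x + δ v x) + ∑[ x < n ] walkInc (v ∷ w) x
    ≡⟨ cong₂ _+_ (trans (∑-distrib-+ (δ u) (δ v)) (cong₂ _+_ (∑-δ u) (∑-δ v))) (handshake (v ∷ w)) ⟩
  2 + 2 * walkLength (v ∷ w)
    ≡⟨ *-suc 2 (walkLength (v ∷ w)) ⟨
  2 * walkLength (u ∷ v ∷ w) ∎
  where open ≡-Reasoning

visits : ∀ {n} → Fin n → List (Fin n) → ℕ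
visits x []      = 0
visits x (u ∷ w) = δ u x + visits x w

visits-++ : ∀ {n} (x : Fin n) v w → visits x (v ++ w) ≡ visits x v + visits x w
visits-++ x []      w = refl
visits-++ x (u ∷ v) w = trans (cong (δ u x +_) (visits-++ x v w)) (sym (+-assoc (δ u x) _ _))

visits-tabulate : ∀ {m n} (f : Fin m → Fin n) x → visits x (tabulate f) ≡ ∑[ i < m ] δ (f i) x
visits-tabulate {zero}  f x = refl
visits-tabulate {suc m} f x = cong (δ (f zero) x +_) (visits-tabulate (f ∘ suc) x)

visits-allFin : ∀ {n} (x : Fin n) → visits x (allFin n) ≡ 1
visits-allFin x = trans (visits-tabulate (λ i → i) x) (trans (sum-cong-≗ (λ i → δ-comm i x)) (∑-δ x))

visits-map-injective : ∀ {m n} {f : Fin m → Fin n} → Injective _≡_ _≡_ f →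
  ∀ x w → visits (f x) (map f w) ≡ visits x w
visits-map-injective inj x []      = refl
visits-map-injective inj x (u ∷ w) = cong₂ _+_ (δ-injective inj u x) (visits-map-injective inj x w)

visits-map-∉ : ∀ {m n} {f : Fin m → Fin n} {y} → (∀ x → f x ≢ y) → ∀ w → visits y (map f w) ≡ 0
visits-map-∉ y∉f []      = refl
visits-map-∉ y∉f (u ∷ w) = cong₂ _+_ (δ-≢ (y∉f u)) (visits-map-∉ y∉f w)

lastVertex : ∀ {A : Set} → A → List A → A
lastVertex u []      = u
lastVertex _ (v ∷ w) = lastVertex v w

lastVertex-∷ʳ : ∀ {A : Set} (u : A) w v → lastVertex u (w ++ v ∷ []) ≡ v
lastVertex-∷ʳ u []      v = refl
lastVertex-∷ʳ u (x ∷ w) v = lastVertex-∷ʳ x w v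

walkInc-visits : ∀ {n} (u : Fin n) w x →
  walkInc (u ∷ w) x + (δ u x + δ (lastVertex u w) x) ≡ 2 * visits x (u ∷ w)
walkInc-visits u []      x = double (δ u x)
  where
  double : ∀ a → 0 + (a + a) ≡ 2 * (a + 0)
  double = solve-∀
walkInc-visits u (v ∷ w) x = begin
  δ u x + δ v x + walkInc (v ∷ w) x + (δ u x + ℓ)  ≡⟨ regroup (δ u x) (δ v x) (walkInc (v ∷ w) x) ℓ ⟩
  2 * δ u x + (walkInc (v ∷ w) x + (δ v x + ℓ))    ≡⟨ cong (2 * δ u x +_) (walkInc-visits v w x) ⟩
  2 * δ u x + 2 * visits x (v ∷ w)                 ≡⟨ *-distribˡ-+ 2 (δ u x) (visits x (v ∷ w)) ⟨
  2 * visits x (u ∷ v ∷ w)                         ∎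
  where
  open ≡-Reasoning
  ℓ = δ (lastVertex v w) x
  regroup : ∀ a b c d → a + b + c + (a + d) ≡ 2 * a + (c + (b + d))
  regroup = solve-∀

isOdd : ℕ → Bool
isOdd zero    = false
isOdd (suc n) = not (isOdd n)

odd? : Decidable (λ x → isOdd x ≡ true)
odd? x = isOdd x ≟ᵇ true

isOdd-double : ∀ k → isOdd (2 * k) ≡ false
isOdd-double zero    = refl
isOdd-double (suc k) = begin
  isOdd (2 * suc k)         ≡⟨ cong isOdd (*-suc 2 k) ⟩
  not (not (isOdd (2 * k))) ≡⟨ not-involutive _ ⟩
  isOdd (2 * k)             ≡⟨ isOdd-double k ⟩
  false                     ∎
  where open ≡-Reasoning

odd⇒1≤ : ∀ {x} → isOdd x ≡ true → 1 ≤ x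
odd⇒1≤ {suc _} _ = s≤s z≤n

<-sameParity⇒2+≤ : ∀ {x y} → x < y → isOdd x ≡ isOdd y → 2 + x ≤ y
<-sameParity⇒2+≤ x<y same with m≤n⇒m<n∨m≡n x<y
... | inj₁ 2+x≤y = 2+x≤y
... | inj₂ refl  = contradiction same (not-¬ refl)

odd-walkInc⇒endpoint : ∀ {n} (u : Fin n) w x →
  isOdd (walkInc (u ∷ w) x) ≡ true → u ≡ x ⊎ lastVertex u w ≡ x
odd-walkInc⇒endpoint u w x odd with u ≟ x | lastVertex u w ≟ x
... | yes u≡x | _       = inj₁ u≡x
... | no _    | yes ℓ≡x = inj₂ ℓ≡x
... | no u≢x  | no ℓ≢x  =
  contradiction (trans (sym odd) (trans (cong isOdd even) (isOdd-double (visits x (u ∷ w))))) λ ()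
  where
  even : walkInc (u ∷ w) x ≡ 2 * visits x (u ∷ w)
  even = begin
    walkInc (u ∷ w) x
      ≡⟨ +-identityʳ _ ⟨
    walkInc (u ∷ w) x + (0 + 0)
      ≡⟨ cong₂ (λ a b → walkInc (u ∷ w) x + (a + b)) (δ-≢ u≢x) (δ-≢ ℓ≢x) ⟨
    walkInc (u ∷ w) x + (δ u x + δ (lastVertex u w) x)
      ≡⟨ walkInc-visits u w x ⟩
    2 * visits x (u ∷ w) ∎
    where open ≡-Reasoning

odd-values : ∀ {n} (w : List (Fin n)) →
  ∃₂ λ p r → ∀ x → isOdd (walkInc w x) ≡ true → walkInc w x ≡ p ⊎ walkInc w x ≡ r
odd-values []      = 0 , 0 , λ _ ()
odd-values (u ∷ w) = walkInc (u ∷ w) u , walkInc (u ∷ w) (lastVertex u w) , λ x odd →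
  ⊎-map (cong (walkInc (u ∷ w)) ∘ sym) (cong (walkInc (u ∷ w)) ∘ sym) (odd-walkInc⇒endpoint u w x odd)

adj-K : ∀ {n} {u v : Fin n} → u ≢ v → adj (K n) u v ≡ true
adj-K {u = u} {v} u≢v with u ≟ v
... | yes u≡v = contradiction u≡v u≢v
... | no _    = refl

adj-K⇒≢ : ∀ {n} {u v : Fin n} → adj (K n) u v ≡ true → u ≢ v
adj-K⇒≢ {n} {u} uv refl = contradiction (trans (sym uv) (irrefl (K n) u)) λ ()

filter-K+visits : ∀ {n} (v : Fin n) xs →
  length (filter (λ u → adj (K n) v u ≟ᵇ true) xs) + visits v xs ≡ length xs
filter-K+visits v []       = refl
filter-K+visits {n} v (x ∷ xs) with v ≟ x
... | yes refl = begin
  ℓ + (δ v v + visits v xs) ≡⟨ cong (λ d → ℓ + (d + visits v xs)) (δ-refl v) ⟩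
  ℓ + suc (visits v xs)     ≡⟨ +-suc ℓ (visits v xs) ⟩
  suc (ℓ + visits v xs)     ≡⟨ cong suc (filter-K+visits v xs) ⟩
  suc (length xs)           ∎
  where
  open ≡-Reasoning
  ℓ = length (filter (λ u → adj (K n) v u ≟ᵇ true) xs)
... | no v≢x   = cong suc (begin
  ℓ + (δ x v + visits v xs) ≡⟨ cong (λ d → ℓ + (d + visits v xs)) (δ-≢ (v≢x ∘ sym)) ⟩
  ℓ + visits v xs           ≡⟨ filter-K+visits v xs ⟩
  length xs                 ∎)
  where
  open ≡-Reasoning
  ℓ = length (filter (λ u → adj (K n) v u ≟ᵇ true) xs)

deg-K : ∀ n (v : Fin n) → deg (K n) v + 1 ≡ n
deg-K n v = begin
  deg (K n) v + 1                   ≡⟨ cong (deg (K n) v +_) (visits-allFin v) ⟨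
  deg (K n) v + visits v (allFin n) ≡⟨ filter-K+visits v (allFin n) ⟩
  length (allFin n)                 ≡⟨ length-tabulate (λ i → i) ⟩
  n                                 ∎
  where open ≡-Reasoning

deg-K-const : ∀ {n} (u v : Fin n) → deg (K n) u ≡ deg (K n) v
deg-K-const {n} u v = +-cancelʳ-≡ 1 _ _ (trans (deg-K n u) (sym (deg-K n v)))

linked⇒walk-K : ∀ {n} {w : List (Fin n)} → Linked _≢_ w → IsWalk (K n) w
linked⇒walk-K []        = tt
linked⇒walk-K [-]       = tt
linked⇒walk-K (u≢v ∷ l) = adj-K u≢v , linked⇒walk-K l

irregularising-K⇒injective : ∀ {n} {w : List (Fin n)} →
  Irregularising (K n) w → Injective _≡_ _≡_ (walkInc w)
irregularising-K⇒injective irr {x} {y} eq =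
  decidable-stable (x ≟ y) λ x≢y → irr x y (adj-K x≢y) (cong₂ _+_ (deg-K-const x y) eq)

injective⇒irregularising-K : ∀ {n} {w : List (Fin n)} →
  Injective _≡_ _≡_ (walkInc w) → Irregularising (K n) w
injective⇒irregularising-K {n} {w} inj u v uv eq =
  adj-K⇒≢ uv (inj (+-cancelˡ-≡ (deg (K n) u) _ _ (trans eq (cong (_+ walkInc w v) (deg-K-const v u)))))

short-walk-collision : ∀ {n} (w : List (Fin (2 + n))) → IsWalk (K (2 + n)) w → walkLength w ≤ 2 →
  ∃₂ λ x y → x ≢ y × walkInc w x ≡ walkInc w y
short-walk-collision []       _ _ = 0F , 1F , (λ ()) , refl
short-walk-collision (u ∷ []) _ _ = 0F , 1F , (λ ()) , refl
short-walk-collision (u ∷ v ∷ []) (uv , _) _ = u , v , u≢v , (begin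
  δ u u + δ v u + 0 ≡⟨ cong₂ (λ a b → a + b + 0) (δ-refl u) (δ-≢ (u≢v ∘ sym)) ⟩
  1                 ≡⟨ cong₂ (λ a b → a + b + 0) (δ-≢ u≢v) (δ-refl v) ⟨
  δ u v + δ v v + 0 ∎)
  where
  open ≡-Reasoning
  u≢v = adj-K⇒≢ uv
short-walk-collision (u ∷ v ∷ w ∷ []) (uv , vw , _) _ with w ≟ u
... | yes refl = u , v , u≢v , (begin
  δ u u + δ v u + (δ v u + δ u u + 0) ≡⟨ cong₂ (λ a b → a + b + (b + a + 0)) (δ-refl u) (δ-≢ (u≢v ∘ sym)) ⟩
  2                                   ≡⟨ cong₂ (λ a b → a + b + (b + a + 0)) (δ-≢ u≢v) (δ-refl v) ⟨
  δ u v + δ v v + (δ v v + δ u v + 0) ∎)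
  where
  open ≡-Reasoning
  u≢v = adj-K⇒≢ uv
... | no w≢u = u , w , w≢u ∘ sym , (begin
  δ u u + δ v u + (δ v u + δ w u + 0) ≡⟨ cong₂ (λ a b → a + b + (b + δ w u + 0)) (δ-refl u) (δ-≢ (adj-K⇒≢ uv ∘ sym)) ⟩
  1 + (δ w u + 0)                     ≡⟨ cong (λ c → 1 + (c + 0)) (δ-≢ w≢u) ⟩
  1                                   ≡⟨ cong (_+ 0) (δ-refl w) ⟨
  δ w w + 0                           ≡⟨ cong₂ (λ a b → a + b + (b + δ w w + 0)) (δ-≢ (w≢u ∘ sym)) (δ-≢ (adj-K⇒≢ vw)) ⟨
  δ u w + δ v w + (δ v w + δ w w + 0) ∎)
  where open ≡-Reasoning
short-walk-collision (_ ∷ _ ∷ _ ∷ _ ∷ _) _ (s≤s (s≤s ()))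

irregularising-K⇒3≤length : ∀ {n} w → IsWalk (K (2 + n)) w → Irregularising (K (2 + n)) w →
  3 ≤ walkLength w
irregularising-K⇒3≤length w walk irr = ≰⇒> λ short →
  let (x , y , x≢y , eq) = short-walk-collision w walk short
  in  x≢y (irregularising-K⇒injective {w = w} irr eq)

-- Sums of distinct naturals with few odd members

filter-partition-↭ : ∀ {a p} {A : Set a} {P : Pred A p} (P? : Decidable P) xs →
  filter P? xs ++ filter (∁? P?) xs ↭ xs
filter-partition-↭ P? []       = ↭-refl
filter-partition-↭ P? (x ∷ xs) with P? x
... | yes _ = ↭-prep x (filter-partition-↭ P? xs)
... | no  _ = ↭-trans (shift x (filter P? xs) _) (↭-prep x (filter-partition-↭ P? xs))

sum-tabulate : ∀ {n} (f : Fin n → ℕ) → sum (tabulate f) ≡ ∑[ i < n ] f i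
sum-tabulate {zero}  f = refl
sum-tabulate {suc n} f = cong (f zero +_) (sum-tabulate (f ∘ suc))

sorted-unique⇒strict : ∀ {xs} → Linked _≤_ xs → Unique xs → Linked _<_ xs
sorted-unique⇒strict []        _               = []
sorted-unique⇒strict [-]       _               = [-]
sorted-unique⇒strict (x≤y ∷ l) ((x≢y ∷ _) ∷ u) = ≤∧≢⇒< x≤y x≢y ∷ sorted-unique⇒strict l u

Gapped : List ℕ → Set
Gapped = Linked (λ x y → 2 + x ≤ y)

gapped-trans : ∀ {x y z} → 2 + x ≤ y → 2 + y ≤ z → 2 + x ≤ z
gapped-trans {y = y} x+2≤y y+2≤z = ≤-trans x+2≤y (≤-trans (m≤n+m y 2) y+2≤z)

strict-sameParity⇒gapped : ∀ b {xs} → Linked _<_ xs → All (λ x → isOdd x ≡ b) xs → Gapped xs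
strict-sameParity⇒gapped b []        _                = []
strict-sameParity⇒gapped b [-]       _                = [-]
strict-sameParity⇒gapped b (x<y ∷ l) (x≡b ∷ y≡b ∷ ps) =
  <-sameParity⇒2+≤ x<y (trans x≡b (sym y≡b)) ∷ strict-sameParity⇒gapped b l (y≡b ∷ ps)

-- That is, sum xs >= k a + k (k - 1) for k = length xs, stated without subtraction.
sum-gapped : ∀ {a xs} → Gapped xs → All (a ≤_) xs →
  length xs * (a + length xs) ≤ sum xs + length xs
sum-gapped []  [] = z≤n
sum-gapped {a} {x ∷ []} [-] (a≤x ∷ []) = begin
  1 * (a + 1) ≡⟨ one a ⟩
  a + 1       ≤⟨ +-monoˡ-≤ 1 a≤x ⟩
  x + 1       ≡⟨ cong (_+ 1) (+-identityʳ x) ⟨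
  x + 0 + 1   ∎
  where
  open ≤-Reasoning
  one : ∀ a → 1 * (a + 1) ≡ a + 1
  one = solve-∀
sum-gapped {a} {x ∷ y ∷ ys} (x+2≤y ∷ g) (a≤x ∷ _) = begin
  (2 + ℓ) * (a + (2 + ℓ))             ≡⟨ expand a ℓ ⟩
  a + (1 + ℓ) * (2 + a + (1 + ℓ)) + 1 ≤⟨ +-monoˡ-≤ 1 (+-mono-≤ a≤x (sum-gapped g 2+a≤ys)) ⟩
  x + (sum (y ∷ ys) + (1 + ℓ)) + 1    ≡⟨ regroup x (sum (y ∷ ys)) ℓ ⟩
  sum (x ∷ y ∷ ys) + (2 + ℓ)          ∎
  where
  open ≤-Reasoning
  ℓ = length ys
  2+a≤ys : All (2 + a ≤_) (y ∷ ys)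
  2+a≤ys = Linked.Linked⇒All gapped-trans (≤-trans (s≤s (s≤s a≤x)) x+2≤y) g
  expand : ∀ a ℓ → (2 + ℓ) * (a + (2 + ℓ)) ≡ a + (1 + ℓ) * (2 + a + (1 + ℓ)) + 1
  expand = solve-∀
  regroup : ∀ x s ℓ → x + (s + (1 + ℓ)) + 1 ≡ x + s + (2 + ℓ)
  regroup = solve-∀

-- That is, o^2 + e (e - 1) >= n^2 - 5n + 10 for n = o + e, with equality when o = 2.
few-odd-arith : ∀ o e → o ≤ 2 → 4 ≤ o + e →
  (o + e) * (o + e) + 10 + (o + e) ≤ o * (1 + o) + e * e + 5 * (o + e)
few-odd-arith 0 e _ 4≤e with m≤n⇒∃[o]m+o≡n 4≤e
... | k , refl = begin
  (4 + k) * (4 + k) + 10 + (4 + k)               ≤⟨ m≤m+n _ (6 + 4 * k) ⟩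
  (4 + k) * (4 + k) + 10 + (4 + k) + (6 + 4 * k) ≡⟨ slack k ⟩
  (4 + k) * (4 + k) + 5 * (4 + k)                ∎
  where
  open ≤-Reasoning
  slack : ∀ k → (4 + k) * (4 + k) + 10 + (4 + k) + (6 + 4 * k) ≡ (4 + k) * (4 + k) + 5 * (4 + k)
  slack = solve-∀
few-odd-arith 1 e _ (s≤s 3≤e) with m≤n⇒∃[o]m+o≡n 3≤e
... | k , refl = begin
  (4 + k) * (4 + k) + 10 + (4 + k)               ≤⟨ m≤m+n _ (1 + 2 * k) ⟩
  (4 + k) * (4 + k) + 10 + (4 + k) + (1 + 2 * k) ≡⟨ slack k ⟩
  1 * 2 + (3 + k) * (3 + k) + 5 * (4 + k)        ∎
  where
  open ≤-Reasoning
  slack : ∀ k → (4 + k) * (4 + k) + 10 + (4 + k) + (1 + 2 * k) ≡ 1 * 2 + (3 + k) * (3 + k) + 5 * (4 + k)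
  slack = solve-∀
few-odd-arith 2 e _ _ = ≤-reflexive (tight e)
  where
  tight : ∀ e → (2 + e) * (2 + e) + 10 + (2 + e) ≡ 2 * 3 + e * e + 5 * (2 + e)
  tight = solve-∀
few-odd-arith (suc (suc (suc _))) _ (s≤s (s≤s ())) _

distinct-sum-bound : ∀ {xs} → Unique xs → length (filter odd? xs) ≤ 2 → 4 ≤ length xs →
  length xs * length xs + 10 ≤ sum xs + 5 * length xs
distinct-sum-bound {xs} uniq few 4≤n = +-cancelʳ-≤ (length xs) _ _ (begin
  length xs * length xs + 10 + length xs ≡⟨ cong (λ m → m * m + 10 + m) o+e≡n ⟨
  (o + e) * (o + e) + 10 + (o + e)       ≤⟨ few-odd-arith o e o≤2 (subst (4 ≤_) (sym o+e≡n) 4≤n) ⟩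
  o * (1 + o) + e * e + 5 * (o + e)      ≤⟨ +-monoˡ-≤ (5 * (o + e)) (+-mono-≤ bound-O bound-E) ⟩
  sum O + o + (sum E + e) + 5 * (o + e)  ≡⟨ regroup (sum O) (sum E) o e ⟩
  sum O + sum E + 5 * (o + e) + (o + e)  ≡⟨ cong₂ (λ s m → s + 5 * m + m) sums o+e≡n ⟩
  sum xs + 5 * length xs + length xs     ∎)
  where
  open ≤-Reasoning
  S = sort xs
  O = filter odd? S
  E = filter (∁? odd?) S
  o = length O
  e = length E
  O++E↭xs : O ++ E ↭ xs
  O++E↭xs = ↭-trans (filter-partition-↭ odd? S) (sort-↭ xs)
  o+e≡n : o + e ≡ length xs
  o+e≡n = trans (sym (length-++ O)) (↭-length O++E↭xs)
  sums : sum O + sum E ≡ sum xs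
  sums = trans (sym (sum-++ O E)) (sum-↭ O++E↭xs)
  o≤2 : o ≤ 2
  o≤2 = subst (_≤ 2) (sym (↭-length (filter-↭ odd? (sort-↭ xs)))) few
  S-strict : Linked _<_ S
  S-strict = sorted-unique⇒strict (sort-↗ xs) (Unique-resp-↭ (↭⇒↭ₛ (↭-sym (sort-↭ xs))) uniq)
  bound-O : o * (1 + o) ≤ sum O + o
  bound-O = sum-gapped
    (strict-sameParity⇒gapped true (Linked.filter⁺ odd? <-trans S-strict) (all-filter odd? S))
    (All.map odd⇒1≤ (all-filter odd? S))
  bound-E : e * e ≤ sum E + e
  bound-E = sum-gapped
    (strict-sameParity⇒gapped false (Linked.filter⁺ (∁? odd?) <-trans S-strict)
      (All.map ¬-not (all-filter (∁? odd?) S)))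
    (All.universal (λ _ → z≤n) E)
  regroup : ∀ a b o e → a + o + (b + e) + 5 * (o + e) ≡ a + b + 5 * (o + e) + (o + e)
  regroup = solve-∀

unique-pair-length : ∀ {a} {A : Set a} {p r : A} {xs} →
  Unique xs → All (λ y → y ≡ p ⊎ y ≡ r) xs → length xs ≤ 2
unique-pair-length {xs = []}         _ _ = z≤n
unique-pair-length {xs = _ ∷ []}     _ _ = s≤s z≤n
unique-pair-length {xs = _ ∷ _ ∷ []} _ _ = s≤s (s≤s z≤n)
unique-pair-length ((x≢y ∷ x≢z ∷ _) ∷ (y≢z ∷ _) ∷ _) (x∈ ∷ y∈ ∷ z∈ ∷ _) = ⊥-elim (collide x∈ y∈ z∈)
  where
  collide : _ → _ → _ → _
  collide (inj₁ x≡p) (inj₁ y≡p) _          = x≢y (trans x≡p (sym y≡p))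
  collide (inj₂ x≡r) (inj₂ y≡r) _          = x≢y (trans x≡r (sym y≡r))
  collide (inj₁ x≡p) (inj₂ _)   (inj₁ z≡p) = x≢z (trans x≡p (sym z≡p))
  collide (inj₂ x≡r) (inj₁ _)   (inj₂ z≡r) = x≢z (trans x≡r (sym z≡r))
  collide (inj₁ _)   (inj₂ y≡r) (inj₂ z≡r) = y≢z (trans y≡r (sym z≡r))
  collide (inj₂ _)   (inj₁ y≡p) (inj₁ z≡p) = y≢z (trans y≡p (sym z≡p))

at-most-two-odd : ∀ {p r xs} → Unique xs → All (λ y → isOdd y ≡ true → y ≡ p ⊎ y ≡ r) xs →
  length (filter odd? xs) ≤ 2
at-most-two-odd {xs = xs} uniq odd⇒pr = unique-pair-length (Unique.filter⁺ odd? uniq)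
  (All.zipWith (λ (imp , odd) → imp odd) (All-filter⁺ odd? odd⇒pr , all-filter odd? xs))

irregularising-K⇒length-bound : ∀ n → 4 ≤ n → ∀ w → Irregularising (K n) w →
  n * n + 10 ≤ 2 * walkLength w + 5 * n
irregularising-K⇒length-bound n 4≤n w irr with odd-values w
... | p , r , odd⇒pr = begin
  n * n + 10                                    ≡⟨ cong (λ m → m * m + 10) len ⟨
  length incs * length incs + 10                ≤⟨ distinct-sum-bound uniq few (subst (4 ≤_) (sym len) 4≤n) ⟩
  sum incs + 5 * length incs                    ≡⟨ cong₂ (λ s m → s + 5 * m) total len ⟩
  2 * walkLength w + 5 * n                      ∎
  where
  open ≤-Reasoning
  incs = tabulate (walkInc w)
  uniq : Unique incs
  uniq = Unique.tabulate⁺ (irregularising-K⇒injective {w = w} irr)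
  few : length (filter odd? incs) ≤ 2
  few = at-most-two-odd uniq (tabulate⁺ odd⇒pr)
  len : length incs ≡ n
  len = length-tabulate (walkInc w)
  total : sum incs ≡ 2 * walkLength w
  total = trans (sum-tabulate (walkInc w)) (handshake w)

-- An optimal walk

last-connected : ∀ {a r} {A : Set a} {R : A → A → Set r} {xs y} →
  All (λ x → R x y) xs → Connected R (last xs) (just y)
last-connected []                = nothing-just
last-connected (Rxy ∷ [])        = just Rxy
last-connected (_ ∷ Rys@(_ ∷ _)) = last-connected Rys

bracket-linked : ∀ {a r} {A : Set a} {R : A → A → Set r} {x xs} → xs ≢ [] →
  All (R x) xs → All (λ y → R y x) xs → Linked R xs → Linked R (x ∷ xs ++ x ∷ [])
bracket-linked {xs = []}    nonempty _         _   _ = contradiction refl nonempty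
bracket-linked {xs = _ ∷ _} _        (Rxy ∷ _) Ryx l = Rxy ∷ Linked.++⁺ l (last-connected Ryx) [-]

staircase : ∀ k → List (Fin k)
staircase zero    = []
staircase (suc k) = map suc (staircase k) ++ allFin (suc k)

visits-staircase : ∀ {k} (x : Fin k) → visits x (staircase k) ≡ suc (toℕ x)
visits-staircase {suc k} x = begin
  visits x (lower ++ allFin (suc k))           ≡⟨ visits-++ x lower (allFin (suc k)) ⟩
  visits x lower + visits x (allFin (suc k))   ≡⟨ cong (visits x lower +_) (visits-allFin x) ⟩
  visits x lower + 1                           ≡⟨ +-comm _ 1 ⟩
  suc (visits x lower)                         ≡⟨ cong suc (visits-lower x) ⟩
  suc (toℕ x)                                  ∎
  where
  open ≡-Reasoning
  lower = map suc (staircase k)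
  visits-lower : ∀ x → visits x lower ≡ toℕ x
  visits-lower zero    = visits-map-∉ (λ _ ()) (staircase k)
  visits-lower (suc y) = trans (visits-map-injective Fin-suc-injective y (staircase k)) (visits-staircase y)

staircase-linked : ∀ k → Linked _≢_ (staircase k)
staircase-linked zero    = []
staircase-linked (suc k) = Linked.++⁺
  (Linked.map⁺ (Linked.map (_∘ Fin-suc-injective) (staircase-linked k)))
  (last-connected (All-map⁺ (All.universal (λ _ ()) (staircase k))))
  (Linked.AllPairs⇒Linked (Unique.allFin⁺ (suc k)))

optimalWalk : ∀ k → List (Fin (4 + k))
optimalWalk k = 1F ∷ 2F ∷ map (3 ↑ʳ_) (staircase (suc k)) ++ 2F ∷ []

optimalInc : ∀ {k} → Fin (4 + k) → ℕ
optimalInc 0F                  = 0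
optimalInc 1F                  = 1
optimalInc 2F                  = 3
optimalInc (suc (suc (suc j))) = 2 * suc (toℕ j)

optimalWalk-linked : ∀ k → Linked _≢_ (optimalWalk k)
optimalWalk-linked k = (λ ()) ∷ bracket-linked nonempty 2≢tower (All.map ≢-sym 2≢tower)
  (Linked.map⁺ (Linked.map (_∘ ↑ʳ-injective 3 _ _) (staircase-linked (suc k))))
  where
  tower = map (3 ↑ʳ_) (staircase (suc k))
  2≢tower : All (2F ≢_) tower
  2≢tower = All-map⁺ (All.universal (λ _ ()) (staircase (suc k)))
  nonempty : tower ≢ []
  nonempty tower≡[] = contradiction (begin
    1                               ≡⟨ visits-staircase {suc k} zero ⟨
    visits zero (staircase (suc k)) ≡⟨ visits-map-injective (↑ʳ-injective 3 _ _) zero (staircase (suc k)) ⟨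
    visits (3 ↑ʳ zero) tower        ≡⟨ cong (visits (3 ↑ʳ zero)) tower≡[] ⟩
    0                               ∎) λ ()
    where open ≡-Reasoning

walkInc-optimalWalk : ∀ {k} (x : Fin (4 + k)) → walkInc (optimalWalk k) x ≡ optimalInc x
walkInc-optimalWalk {k} x = +-cancelʳ-≡ (δ 1F x + δ 2F x) _ _ (begin
  walkInc W x + (δ 1F x + δ 2F x)
    ≡⟨ cong (λ v → walkInc W x + (δ 1F x + δ v x)) (lastVertex-∷ʳ 1F (2F ∷ tower) 2F) ⟨
  walkInc W x + (δ 1F x + δ (lastVertex 1F (2F ∷ tower ++ 2F ∷ [])) x)
    ≡⟨ walkInc-visits 1F (2F ∷ tower ++ 2F ∷ []) x ⟩
  2 * (δ 1F x + (δ 2F x + visits x (tower ++ 2F ∷ [])))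
    ≡⟨ cong (λ v → 2 * (δ 1F x + (δ 2F x + v))) (visits-++ x tower (2F ∷ [])) ⟩
  2 * (δ 1F x + (δ 2F x + (visits x tower + (δ 2F x + 0))))
    ≡⟨ doubled-visits x ⟩
  optimalInc x + (δ 1F x + δ 2F x) ∎)
  where
  open ≡-Reasoning
  W = optimalWalk k
  tower = map (3 ↑ʳ_) (staircase (suc k))
  doubled-visits : ∀ x →
    2 * (δ 1F x + (δ 2F x + (visits x tower + (δ 2F x + 0)))) ≡ optimalInc x + (δ 1F x + δ 2F x)
  doubled-visits 0F = cong (λ v → 2 * (v + 0)) (visits-map-∉ (λ _ ()) (staircase (suc k)))
  doubled-visits 1F = cong (λ v → 2 * (1 + (v + 0))) (visits-map-∉ (λ _ ()) (staircase (suc k)))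
  doubled-visits 2F = cong (λ v → 2 * (1 + (v + 1))) (visits-map-∉ (λ _ ()) (staircase (suc k)))
  doubled-visits (suc (suc (suc j))) = begin
    2 * (visits (3 ↑ʳ j) tower + 0)
      ≡⟨ cong (λ v → 2 * (v + 0)) (visits-map-injective (↑ʳ-injective 3 _ _) j (staircase (suc k))) ⟩
    2 * (visits j (staircase (suc k)) + 0)
      ≡⟨ cong (λ v → 2 * (v + 0)) (visits-staircase j) ⟩
    2 * (suc (toℕ j) + 0)
      ≡⟨ cong (2 *_) (+-identityʳ (suc (toℕ j))) ⟩
    2 * suc (toℕ j)
      ≡⟨ +-identityʳ (2 * suc (toℕ j)) ⟨
    2 * suc (toℕ j) + 0 ∎

optimalInc-injective : ∀ {k} → Injective _≡_ _≡_ (optimalInc {k})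
optimalInc-injective {x = 0F}                {0F}                _  = refl
optimalInc-injective {x = 1F}                {1F}                _  = refl
optimalInc-injective {x = 2F}                {2F}                _  = refl
optimalInc-injective {x = suc (suc (suc i))} {suc (suc (suc j))} eq =
  cong (3 ↑ʳ_) (toℕ-injective (suc-injective (*-cancelˡ-≡ _ _ 2 eq)))
optimalInc-injective {x = 0F}                {1F}                ()
optimalInc-injective {x = 0F}                {2F}                ()
optimalInc-injective {x = 0F}                {suc (suc (suc _))} ()
optimalInc-injective {x = 1F}                {0F}                ()
optimalInc-injective {x = 1F}                {2F}                ()
optimalInc-injective {x = 1F}                {suc (suc (suc j))} eq = contradiction (sym eq) (even≢odd (suc (toℕ j)) 0)
optimalInc-injective {x = 2F}                {0F}                ()
optimalInc-injective {x = 2F}                {1F}                ()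
optimalInc-injective {x = 2F}                {suc (suc (suc j))} eq = contradiction (sym eq) (even≢odd (suc (toℕ j)) 1)
optimalInc-injective {x = suc (suc (suc _))} {0F}                ()
optimalInc-injective {x = suc (suc (suc i))} {1F}                eq = contradiction eq (even≢odd (suc (toℕ i)) 0)
optimalInc-injective {x = suc (suc (suc i))} {2F}                eq = contradiction eq (even≢odd (suc (toℕ i)) 1)

optimalWalk-irregularising : ∀ k → Irregularising (K (4 + k)) (optimalWalk k)
optimalWalk-irregularising k = injective⇒irregularising-K {w = optimalWalk k} λ {x} {y} eq →
  optimalInc-injective (trans (sym (walkInc-optimalWalk {k} x)) (trans eq (walkInc-optimalWalk y)))

∑-double-suc : ∀ m → ∑[ j < m ] (2 * suc (toℕ j)) ≡ m * suc m
∑-double-suc zero    = refl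
∑-double-suc (suc m) = begin
  ∑[ j < suc m ] (2 * suc (toℕ j))
    ≡⟨ sum-init-last (λ j → 2 * suc (toℕ j)) ⟩
  ∑[ j < m ] (2 * suc (toℕ (inject₁ j))) + 2 * suc (toℕ (fromℕ m))
    ≡⟨ cong₂ _+_ init≡ (cong (λ t → 2 * suc t) (toℕ-fromℕ m)) ⟩
  m * suc m + 2 * suc m
    ≡⟨ step m ⟩
  suc m * suc (suc m) ∎
  where
  open ≡-Reasoning
  init≡ : ∑[ j < m ] (2 * suc (toℕ (inject₁ j))) ≡ m * suc m
  init≡ = trans (sum-cong-≗ {m} (λ j → cong (λ t → 2 * suc t) (toℕ-inject₁ j))) (∑-double-suc m)
  step : ∀ m → m * suc m + 2 * suc m ≡ suc m * suc (suc m)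
  step = solve-∀

optimalWalk-length : ∀ k m → 2 * m + 5 * (4 + k) ≡ (4 + k) * (4 + k) + 10 →
  walkLength (optimalWalk k) ≡ m
optimalWalk-length k m eq = *-cancelˡ-≡ _ _ 2 (begin
  2 * walkLength (optimalWalk k)           ≡⟨ handshake (optimalWalk k) ⟨
  ∑[ x < 4 + k ] walkInc (optimalWalk k) x ≡⟨ sum-cong-≗ (walkInc-optimalWalk {k}) ⟩
  4 + ∑[ j < suc k ] (2 * suc (toℕ j))     ≡⟨ cong (4 +_) (∑-double-suc (suc k)) ⟩
  4 + suc k * suc (suc k)                  ≡⟨ +-cancelʳ-≡ (5 * (4 + k)) _ _ (trans (shape k) (sym eq)) ⟩
  2 * m                                    ∎)
  where
  open ≡-Reasoning
  shape : ∀ k → 4 + suc k * suc (suc k) + 5 * (4 + k) ≡ (4 + k) * (4 + k) + 10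
  shape = solve-∀

triangleWalk : List (Fin 3)
triangleWalk = 0F ∷ 1F ∷ 2F ∷ 1F ∷ []

triangleWalk-irregularising : Irregularising (K 3) triangleWalk
triangleWalk-irregularising = toWitness {a? = all? λ u → all? λ v →
  (adj (K 3) u v ≟ᵇ true) →-dec ¬? (degPlus (K 3) triangleWalk u ≟ℕ degPlus (K 3) triangleWalk v)} _

theorem5p1 : MLW≡ (K 3) 3
    × (∀ (n : ℕ) → 4 ≤ n → ∀ (m : ℕ) → 2 * m + 5 * n ≡ n * n + 10 → MLW≡ (K n) m)
theorem5p1 =
  ((triangleWalk , (refl , refl , refl , tt) , triangleWalk-irregularising , refl) , irregularising-K⇒3≤length) ,
  complete
  where
  complete : ∀ n → 4 ≤ n → ∀ m → 2 * m + 5 * n ≡ n * n + 10 → MLW≡ (K n) m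
  complete n 4≤n m eq with m≤n⇒∃[o]m+o≡n 4≤n
  ... | k , refl =
    (optimalWalk k , linked⇒walk-K (optimalWalk-linked k) , optimalWalk-irregularising k , optimalWalk-length k m eq) ,
    λ w _ irr → *-cancelˡ-≤ 2 (+-cancelʳ-≤ (5 * (4 + k)) _ _
      (subst (_≤ 2 * walkLength w + 5 * (4 + k)) (sym eq) (irregularising-K⇒length-bound (4 + k) 4≤n w irr)))
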